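{- For every simple digraph $\Gamma$, $\operatorname{th}(\Gamma)=\operatorname{th}(\Gamma^T)$.
   Context: A simple digraph $\Gamma$ has a finite vertex set and no loops or parallel arcs (opposite arcs allowed). The transpose $\Gamma^T$ is obtained by reversing every arc. $v$ is an out-neighbor of $u$ if $(u,v)\in E(\Gamma)$. Zero forcing: vertices are blue or white; a blue vertex $u$ with exactly one white out-neighbor $w$ may force $w$ ($u\to w$), turning it blue. A set $\mathcal F$ of forces is a set of forces of $B\subseteq V(\Gamma)$ if, starting with exactly $B$ blue, the forces in $\mathcal F$ can be validly performed in some order after which no further force is possible. Put $\mathcal F^{[0]}=B$ and $\mathcal F^{[t+1]}=\mathcal F^{[t]}\cup\{w\notin\mathcal F^{[t]}:(u\to w)\in\mathcal F,\ u\in\mathcal F^{[t]},\ w$ the only out-neighbor of $u$ outside $\mathcal F^{[t]}\}$; $\operatorname{pt}(\Gamma;\mathcal F)$ is the least $t$ with $\mathcal F^{[t]}=V(\Gamma)$ ($\infty$ if none); $\operatorname{pt}(\Gamma;B)=\min_{\mathcal F}\operatorname{pt}(\Gamma;\mathcal F)$. The throttling number is $\operatorname{th}(\Gamma)=\min_{B\subseteq V(\Gamma)}(|B|+\operatorname{pt}(\Gamma;B))$. -}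

module Defs where

open import Data.Nat using (ℕ; zero; suc; _+_; _≤_; _<_)
open import Data.Fin using (Fin)
open import Data.Fin.Subset using (Subset; _∈_; _∉_; ∣_∣)
open import Data.Vec using (_[_]≔_)
open import Data.Bool using (Bool; true; false)
open import Data.List using (List; []; _∷_)
open import Data.List.Membership.Propositional using () renaming (_∈_ to _∈ₗ_)
open import Data.Product using (Σ; _×_; _,_)
open import Data.Sum using (_⊎_)
open import Data.Unit using (⊤)
open import Relation.Nullary using (¬_)
open import Relation.Binary.PropositionalEquality using (_≡_)
open import Function.Bundles using (_⇔_)

-- A simple digraph on vertex set Fin n: an arc relation without loops.
-- (A relation has no parallel arcs; opposite arcs are allowed.)
record Digraph (n : ℕ) : Set where
  field
    arc      : Fin n → Fin n → Bool
    loopless : ∀ v → arc v v ≡ false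
open Digraph public

transpose : ∀ {n} → Digraph n → Digraph n
transpose Γ = record { arc = λ u v → arc Γ v u ; loopless = loopless Γ }

Force : ℕ → Set
Force n = Fin n × Fin n

ForceSet : ℕ → Set
ForceSet n = Force n → Bool

OnlyWhiteOut : ∀ {n} → Digraph n → Subset n → Fin n → Fin n → Set
OnlyWhiteOut Γ S u w =
  (arc Γ u w ≡ true) × (w ∉ S) × (∀ x → arc Γ u x ≡ true → x ∉ S → x ≡ w)

CanForce : ∀ {n} → Digraph n → Subset n → Fin n → Fin n → Set
CanForce Γ S u w = (u ∈ S) × OnlyWhiteOut Γ S u w

ValidSeq : ∀ {n} → Digraph n → Subset n → List (Force n) → Set
ValidSeq Γ S [] = ⊤
ValidSeq Γ S ((u , w) ∷ L) = CanForce Γ S u w × ValidSeq Γ (S [ w ]≔ true) L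

afterSeq : ∀ {n} → Subset n → List (Force n) → Subset n
afterSeq S [] = S
afterSeq S ((u , w) ∷ L) = afterSeq (S [ w ]≔ true) L

Stalled : ∀ {n} → Digraph n → Subset n → Set
Stalled Γ S = ∀ u w → ¬ CanForce Γ S u w

IsSetOfForces : ∀ {n} → Digraph n → Subset n → ForceSet n → Set
IsSetOfForces {n} Γ B F =
  Σ (List (Force n)) λ L →
    (∀ f → (f ∈ₗ L) ⇔ (F f ≡ true)) × ValidSeq Γ B L × Stalled Γ (afterSeq B L)

Blue : ∀ {n} → Digraph n → Subset n → ForceSet n → ℕ → Fin n → Set
Blue Γ B F zero v = v ∈ B
Blue {n} Γ B F (suc t) w =
  Blue Γ B F t w ⊎
  ((¬ Blue Γ B F t w) ×
   Σ (Fin n) λ u → (F (u , w) ≡ true) × Blue Γ B F t u × (arc Γ u w ≡ true) ×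
     (∀ x → arc Γ u x ≡ true → ¬ Blue Γ B F t x → x ≡ w))

AllBlue : ∀ {n} → Digraph n → Subset n → ForceSet n → ℕ → Set
AllBlue Γ B F t = ∀ v → Blue Γ B F t v

PT : ∀ {n} → Digraph n → Subset n → ForceSet n → ℕ → Set
PT Γ B F t = AllBlue Γ B F t × (∀ s → s < t → ¬ AllBlue Γ B F s)

-- th(Γ) = k: k is the minimum of |B| + pt(Γ; F) over all B ⊆ V(Γ) and all
-- sets of forces F of B with finite propagation time
-- (equivalently the minimum over B of |B| + pt(Γ; B)).
IsThrottlingNumber : ∀ {n} → Digraph n → ℕ → Set
IsThrottlingNumber {n} Γ k =
  (Σ (Subset n) λ B → Σ (ForceSet n) λ F → Σ ℕ λ t →
      IsSetOfForces Γ B F × PT Γ B F t × (∣ B ∣ + t ≡ k)) ×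
  (∀ (B : Subset n) (F : ForceSet n) (t : ℕ) →
      IsSetOfForces Γ B F → PT Γ B F t → k ≤ ∣ B ∣ + t)

module Submission where

-- Fix B, a set of forces F of B with a valid ordering L, and propagation time t.
-- Let T be the set of vertices that force nothing. Performing the transposed
-- forces w → u of L in reverse order is valid in Γᵀ starting from T, and it
-- colours everything (reversal lemma); counting the forces gives |T| = |B|.
-- Moreover, if u → w is in F and w is still white at time s while everything is
-- blue at time j + s, then u is blue at time j in Γᵀ; hence the transposed
-- forces reach all vertices by time t, and applying the same fact to Γᵀ shows
-- they cannot do so earlier (duality of times). So every throttling
-- configuration of Γ has one of Γᵀ of the same cost, and conversely since
-- Γᵀᵀ = Γ. Finally, the throttling number exists: achievability of a cost is
-- decidable (sets of forces are determined by orderings of length at most n)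
-- and cost n is achieved by colouring everything, so a least cost exists.

open import Defs
open import Data.Nat using (ℕ; zero; suc; _+_; _∸_; _≤_; _<_; z≤n; s≤s)
open import Data.Nat.Properties
  using (+-suc; +-identityʳ; +-cancelʳ-≡; ≤-refl; ≤-antisym; ≮⇒≥; m≤n⇒m<n∨m≡n; m≤m+n; m+n≤o⇒n≤o; m+[n∸m]≡n; m+n∸m≡n;
         anyUpTo?; allUpTo?)
  renaming (_≤?_ to _≤ℕ?_)
open import Data.Fin using (Fin; zero; suc; _≟_)
open import Data.Fin.Subset using (Subset; _∈_; _∉_; ∣_∣) renaming (⊤ to everyone)
open import Data.Fin.Subset.Properties using (_∈?_; ∣p∣≤n; ∣⊤∣≡n; ∈⊤; p⊆q⇒∣p∣≤∣q∣; anySubset?)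
open import Data.Fin.Properties using (any?; all?)
open import Data.Vec using (_∷_; here; there; _[_]≔_; tabulate)
open import Data.Vec.Properties using ([]≔-updates; []≔-minimal; lookup∘update′; lookup⇒[]=; []=⇒lookup; lookup∘tabulate)
open import Data.Bool using (Bool; true; false)
open import Data.Bool.Properties using (T-≡) renaming (_≟_ to _≟ᵇ_)
open import Data.List using (List; []; _∷_; _++_; [_]; length; map; reverse)
open import Data.List.Properties using (unfold-reverse; length-reverse; length-map)
open import Data.List.Membership.Propositional using () renaming (_∈_ to _∈ₗ_)
import Data.List.Membership.DecPropositional as DecMembership
import Data.List.Relation.Unary.Any as Any
import Data.List.Relation.Unary.Any.Properties as Anyₚ
open import Data.Product using (Σ; ∃; _×_; _,_; proj₁; proj₂; swap)
open import Data.Product.Properties using (≡-dec)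
open import Data.Sum using (_⊎_; inj₁; inj₂)
open import Data.Unit using (tt)
open import Data.Empty using (⊥; ⊥-elim)
open import Function using (_∘_)
open import Function.Bundles using (_⇔_; mk⇔; Equivalence)
open import Function.Construct.Composition using (_⇔-∘_)
open import Relation.Nullary using (¬_; Dec; yes; no)
open import Relation.Nullary.Decidable using (_×-dec_; _⊎-dec_; _→-dec_; ¬?; map′; isYes; toWitness; fromWitness)
open import Relation.Binary.PropositionalEquality using (_≡_; _≢_; refl; sym; trans; cong; subst; module ≡-Reasoning)

open Equivalence using (to; from)

-- Blue-set bookkeeping: painting w blue is the update S [ w ]≔ true.

∈-paint : ∀ {n} (S : Subset n) w → w ∈ S [ w ]≔ true
∈-paint S w = []≔-updates S w

paint-mono : ∀ {n} (S : Subset n) w {x} → x ∈ S → x ∈ S [ w ]≔ true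
paint-mono S w {x} x∈S with x ≟ w
... | yes refl = ∈-paint S w
... | no x≢w = []≔-minimal S x w x≢w x∈S

paint-back : ∀ {n} (S : Subset n) w {x} → x ∈ S [ w ]≔ true → x ≢ w → x ∈ S
paint-back S w {x} x∈S' x≢w =
  lookup⇒[]= x S (trans (sym (lookup∘update′ x≢w S true)) ([]=⇒lookup x∈S'))

∣paint∣ : ∀ {n} (S : Subset n) w → w ∉ S → ∣ S [ w ]≔ true ∣ ≡ suc ∣ S ∣
∣paint∣ (true ∷ S) zero w∉S = ⊥-elim (w∉S here)
∣paint∣ (false ∷ S) zero _ = refl
∣paint∣ (true ∷ S) (suc w) w∉S = cong suc (∣paint∣ S w (w∉S ∘ there))
∣paint∣ (false ∷ S) (suc w) w∉S = ∣paint∣ S w (w∉S ∘ there)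

∣everything∣ : ∀ {n} (S : Subset n) → (∀ x → x ∈ S) → ∣ S ∣ ≡ n
∣everything∣ {n} S all =
  ≤-antisym (∣p∣≤n S)
    (subst (_≤ ∣ S ∣) (∣⊤∣≡n n) (p⊆q⇒∣p∣≤∣q∣ {p = everyone} (λ {x} _ → all x)))

comprehension : ∀ {n} (P : Fin n → Set) → (∀ v → Dec (P v)) →
  Σ (Subset n) λ S → ∀ v → v ∈ S ⇔ P v
comprehension P P? = tabulate (isYes ∘ P?) , λ v → mk⇔
  (λ v∈S → toWitness {a? = P? v}
    (from T-≡ (trans (sym (lookup∘tabulate (isYes ∘ P?) v)) ([]=⇒lookup v∈S))))
  (λ p → lookup⇒[]= v _
    (trans (lookup∘tabulate (isYes ∘ P?) v) (to T-≡ (fromWitness {a? = P? v} p))))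

-- Anatomy of a valid sequence of forces.

no-loop : ∀ {n} (Γ : Digraph n) {u} → ¬ arc Γ u u ≡ true
no-loop Γ {u} u→u with trans (sym u→u) (loopless Γ u)
... | ()

afterSeq-mono : ∀ {n} (S : Subset n) L {x} → x ∈ S → x ∈ afterSeq S L
afterSeq-mono S [] x∈S = x∈S
afterSeq-mono S ((u , w) ∷ L) x∈S = afterSeq-mono (S [ w ]≔ true) L (paint-mono S w x∈S)

afterSeq-target : ∀ {n} (S : Subset n) L {u w} → (u , w) ∈ₗ L → w ∈ afterSeq S L
afterSeq-target S ((u , w) ∷ L) (Any.here refl) = afterSeq-mono (S [ w ]≔ true) L (∈-paint S w)
afterSeq-target S ((_ , b) ∷ L) (Any.there m) = afterSeq-target (S [ b ]≔ true) L m

valid-arc : ∀ {n} (Γ : Digraph n) S L {u w} → ValidSeq Γ S L → (u , w) ∈ₗ L → arc Γ u w ≡ true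
valid-arc Γ S ((a , b) ∷ L) ((_ , a→b , _) , _) (Any.here refl) = a→b
valid-arc Γ S ((a , b) ∷ L) (_ , valid) (Any.there m) = valid-arc Γ (S [ b ]≔ true) L valid m

valid-target-white : ∀ {n} (Γ : Digraph n) S L {u w} → ValidSeq Γ S L → (u , w) ∈ₗ L → w ∉ S
valid-target-white Γ S ((a , b) ∷ L) ((_ , _ , b∉S , _) , _) (Any.here refl) = b∉S
valid-target-white Γ S ((a , b) ∷ L) (_ , valid) (Any.there m) =
  valid-target-white Γ (S [ b ]≔ true) L valid m ∘ paint-mono S b

-- A vertex performs at most one force: after forcing, it has no white out-neighbour.
valid-one-target : ∀ {n} (Γ : Digraph n) S L {u w w'} → ValidSeq Γ S L →
  (u , w) ∈ₗ L → (u , w') ∈ₗ L → w ≡ w'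
valid-one-target Γ S ((a , b) ∷ L) _ (Any.here refl) (Any.here refl) = refl
valid-one-target Γ S ((a , b) ∷ L) ((_ , _ , _ , only) , valid) (Any.here refl) (Any.there m) =
  sym (only _ (valid-arc Γ _ L valid m) (valid-target-white Γ _ L valid m ∘ paint-mono S b))
valid-one-target Γ S ((a , b) ∷ L) ((_ , _ , _ , only) , valid) (Any.there m) (Any.here refl) =
  only _ (valid-arc Γ _ L valid m) (valid-target-white Γ _ L valid m ∘ paint-mono S b)
valid-one-target Γ S ((a , b) ∷ L) (_ , valid) (Any.there m) (Any.there m') =
  valid-one-target Γ _ L valid m m'

-- A vertex is forced at most once: afterwards it is no longer white.
valid-one-forcer : ∀ {n} (Γ : Digraph n) S L {u u' w} → ValidSeq Γ S L →
  (u , w) ∈ₗ L → (u' , w) ∈ₗ L → u ≡ u'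
valid-one-forcer Γ S ((a , b) ∷ L) _ (Any.here refl) (Any.here refl) = refl
valid-one-forcer Γ S ((a , b) ∷ L) (_ , valid) (Any.here refl) (Any.there m) =
  ⊥-elim (valid-target-white Γ _ L valid m (∈-paint S b))
valid-one-forcer Γ S ((a , b) ∷ L) (_ , valid) (Any.there m) (Any.here refl) =
  ⊥-elim (valid-target-white Γ _ L valid m (∈-paint S b))
valid-one-forcer Γ S ((a , b) ∷ L) (_ , valid) (Any.there m) (Any.there m') =
  valid-one-forcer Γ _ L valid m m'

∣afterSeq∣ : ∀ {n} (Γ : Digraph n) S L → ValidSeq Γ S L → ∣ afterSeq S L ∣ ≡ ∣ S ∣ + length L
∣afterSeq∣ Γ S [] _ = sym (+-identityʳ ∣ S ∣)
∣afterSeq∣ Γ S ((a , b) ∷ L) ((_ , _ , b∉S , _) , valid) = begin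
  ∣ afterSeq (S [ b ]≔ true) L ∣        ≡⟨ ∣afterSeq∣ Γ _ L valid ⟩
  ∣ S [ b ]≔ true ∣ + length L          ≡⟨ cong (_+ length L) (∣paint∣ S b b∉S) ⟩
  suc ∣ S ∣ + length L                  ≡⟨ sym (+-suc ∣ S ∣ (length L)) ⟩
  ∣ S ∣ + suc (length L)                ∎
  where open ≡-Reasoning

valid-covers : ∀ {n} (Γ : Digraph n) S L → ValidSeq Γ S L → (∀ v → v ∈ afterSeq S L) →
  ∣ S ∣ + length L ≡ n
valid-covers Γ S L valid all = trans (sym (∣afterSeq∣ Γ S L valid)) (∣everything∣ _ all)

valid-snoc : ∀ {n} (Γ : Digraph n) S L {u w} → ValidSeq Γ S L →
  CanForce Γ (afterSeq S L) u w → ValidSeq Γ S (L ++ [ (u , w) ])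
valid-snoc Γ S [] _ can = can , tt
valid-snoc Γ S ((a , b) ∷ L) (can₀ , valid) can = can₀ , valid-snoc Γ _ L valid can

afterSeq-snoc : ∀ {n} (S : Subset n) L u w → afterSeq S (L ++ [ (u , w) ]) ≡ afterSeq S L [ w ]≔ true
afterSeq-snoc S [] u w = refl
afterSeq-snoc S ((a , b) ∷ L) u w = afterSeq-snoc _ L u w

-- Reversing forcing chains.

transposeSeq : ∀ {n} → List (Force n) → List (Force n)
transposeSeq L = reverse (map swap L)

∈-transposeSeq : ∀ {n} (L : List (Force n)) {u w} → (u , w) ∈ₗ transposeSeq L ⇔ (w , u) ∈ₗ L
∈-transposeSeq L = mk⇔
  (λ m → Any.map (cong swap) (Anyₚ.map⁻ (Anyₚ.reverse⁻ m)))
  (λ m → Anyₚ.reverse⁺ (Anyₚ.map⁺ (Any.map (cong swap) m)))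

length-transposeSeq : ∀ {n} (L : List (Force n)) → length (transposeSeq L) ≡ length L
length-transposeSeq L = trans (length-reverse (map swap L)) (length-map swap L)

IsForcer : ∀ {n} → List (Force n) → Fin n → Set
IsForcer {n} L v = ∃ λ w → (v , w) ∈ₗ L

-- Let L be valid from S in Γ and let D be a set of vertices that
-- are blue together with all their out-neighbours. Starting from the vertices E
-- that are neither in D nor forcers of L, the transposed reversed sequence is
-- valid in Γᵀ and paints exactly the vertices outside D: the last force u → w of
-- L becomes the first force w → u, and so on backwards.
reverse-valid : ∀ {n} (Γ : Digraph n) S L (D : Fin n → Set) E → ValidSeq Γ S L →
  (∀ {x} → D x → x ∈ S × (∀ y → arc Γ x y ≡ true → y ∈ S)) →
  (∀ v → (v ∈ E) ⇔ (¬ D v × ¬ IsForcer L v)) →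
  ValidSeq (transpose Γ) E (transposeSeq L) × (∀ v → (v ∈ afterSeq E (transposeSeq L)) ⇔ (¬ D v))
reverse-valid Γ S [] D E _ _ E-spec =
  tt , λ v → mk⇔ (proj₁ ∘ to (E-spec v)) (λ ¬Dv → from (E-spec v) (¬Dv , λ ()))
reverse-valid {n} Γ S ((u , w) ∷ L) D E ((u∈S , u→w , w∉S , only) , valid) closed E-spec =
  subst (λ M → ValidSeq Γ' E M × (∀ v → (v ∈ afterSeq E M) ⇔ (¬ D v)))
        (sym (unfold-reverse (w , u) (map swap L)))
        (valid-snoc Γ' E (transposeSeq L) valid₀ w→u ,
         λ v → subst (λ X → (v ∈ X) ⇔ (¬ D v)) (sym (afterSeq-snoc E (transposeSeq L) w u)) (painted v))
  where
  Γ' : Digraph n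
  Γ' = transpose Γ
  -- u has now done its force: it joins D.
  D' : Fin n → Set
  D' x = D x ⊎ x ≡ u
  ¬D-targets : ∀ {x} → arc Γ x w ≡ true → ¬ D x
  ¬D-targets x→w Dx = w∉S (proj₂ (closed Dx) w x→w)
  closed' : ∀ {x} → D' x → x ∈ S [ w ]≔ true × (∀ y → arc Γ x y ≡ true → y ∈ S [ w ]≔ true)
  closed' (inj₁ Dx) =
    paint-mono S w (proj₁ (closed Dx)) , λ y x→y → paint-mono S w (proj₂ (closed Dx) y x→y)
  closed' (inj₂ refl) = paint-mono S w u∈S , out
    where
    out : ∀ y → arc Γ u y ≡ true → y ∈ S [ w ]≔ true
    out y u→y with y ∈? S
    ... | yes y∈S = paint-mono S w y∈S
    ... | no y∉S rewrite only y u→y y∉S = ∈-paint S w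
  E-spec' : ∀ v → (v ∈ E) ⇔ (¬ D' v × ¬ IsForcer L v)
  E-spec' v = mk⇔
    (λ v∈E → let (¬Dv , ¬forcer) = to (E-spec v) v∈E in
      (λ { (inj₁ Dv) → ¬Dv Dv ; (inj₂ refl) → ¬forcer (w , Any.here refl) }) ,
      (λ { (y , m) → ¬forcer (y , Any.there m) }))
    (λ (¬D'v , ¬forcer) → from (E-spec v) ((¬D'v ∘ inj₁) ,
      λ { (y , Any.here refl) → ¬D'v (inj₂ refl) ; (y , Any.there m) → ¬forcer (y , m) }))
  C : Subset n
  C = afterSeq E (transposeSeq L)
  induction : ValidSeq Γ' E (transposeSeq L) × (∀ v → (v ∈ C) ⇔ (¬ D' v))
  induction = reverse-valid Γ (S [ w ]≔ true) L D' E valid closed' E-spec'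
  valid₀ : ValidSeq Γ' E (transposeSeq L)
  valid₀ = proj₁ induction
  painted₀ : ∀ v → (v ∈ C) ⇔ (¬ D' v)
  painted₀ = proj₂ induction
  w→u : CanForce Γ' C w u
  w→u = from (painted₀ w) (λ { (inj₁ Dw) → w∉S (proj₁ (closed Dw))
                             ; (inj₂ w≡u) → no-loop Γ (subst (λ x → arc Γ u x ≡ true) w≡u u→w) }) ,
        u→w , (λ u∈C → to (painted₀ u) u∈C (inj₂ refl)) , only'
    where
    only' : ∀ x → arc Γ x w ≡ true → x ∉ C → x ≡ u
    only' x x→w x∉C with x ≟ u
    ... | yes x≡u = x≡u
    ... | no x≢u = ⊥-elim (x∉C (from (painted₀ x)
            λ { (inj₁ Dx) → ¬D-targets x→w Dx ; (inj₂ e) → x≢u e }))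
  painted : ∀ v → (v ∈ C [ u ]≔ true) ⇔ (¬ D v)
  painted v with v ≟ u
  ... | yes refl = mk⇔ (λ _ → ¬D-targets u→w) (λ _ → ∈-paint C u)
  ... | no v≢u = mk⇔ (λ v∈C' → to (painted₀ v) (paint-back C u v∈C' v≢u) ∘ inj₁)
                     (λ ¬Dv → paint-mono C u (from (painted₀ v)
                        λ { (inj₁ Dv) → ¬Dv Dv ; (inj₂ e) → v≢u e }))

-- Propagation time in the transpose.

transposeForces : ∀ {n} → ForceSet n → ForceSet n
transposeForces F = F ∘ swap

blue? : ∀ {n} (Γ : Digraph n) B F t v → Dec (Blue Γ B F t v)
blue? Γ B F zero v = v ∈? B
blue? Γ B F (suc t) w = blue? Γ B F t w ⊎-dec (¬? (blue? Γ B F t w) ×-dec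
  any? (λ u → (F (u , w) ≟ᵇ true) ×-dec blue? Γ B F t u ×-dec (arc Γ u w ≟ᵇ true) ×-dec
     all? (λ x → (arc Γ u x ≟ᵇ true) →-dec (¬? (blue? Γ B F t x) →-dec (x ≟ w)))))

initial-blue : ∀ {n} (Γ : Digraph n) B F t {v} → v ∈ B → Blue Γ B F t v
initial-blue Γ B F zero v∈B = v∈B
initial-blue Γ B F (suc t) v∈B = inj₁ (initial-blue Γ B F t v∈B)

blue-origin : ∀ {n} (Γ : Digraph n) B F t {v} → Blue Γ B F t v → v ∈ B ⊎ ∃ λ u → F (u , v) ≡ true
blue-origin Γ B F zero v∈B = inj₁ v∈B
blue-origin Γ B F (suc t) (inj₁ b) = blue-origin Γ B F t b
blue-origin Γ B F (suc t) (inj₂ (_ , u , f , _)) = inj₂ (u , f)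

module Duality {n} (Γ : Digraph n) (B : Subset n) (F : ForceSet n) (B' : Subset n)
  (one-forcer : ∀ {u u' w} → F (u , w) ≡ true → F (u' , w) ≡ true → u ≡ u')
  (target-white : ∀ {u w} → F (u , w) ≡ true → w ∉ B)
  (along-arc : ∀ {u w} → F (u , w) ≡ true → arc Γ u w ≡ true)
  (terminal-in-B' : ∀ {v} → (∀ y → F (v , y) ≢ true) → v ∈ B') where

  Γ' : Digraph n
  Γ' = transpose Γ
  F' : ForceSet n
  F' = transposeForces F

  forces? : ∀ v → Dec (∃ λ y → F (v , y) ≡ true)
  forces? v = any? (λ y → F (v , y) ≟ᵇ true)

  valid-before : ∀ s {x y} → Blue Γ B F (suc s) y → F (x , y) ≡ true →
    Blue Γ B F s x × (∀ z → arc Γ x z ≡ true → ¬ Blue Γ B F s z → z ≡ y)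
  valid-before zero (inj₁ y∈B) f = ⊥-elim (target-white f y∈B)
  valid-before (suc s) (inj₁ b) f =
    let (bx , only) = valid-before s b f in inj₁ bx , λ z x→z ¬bz → only z x→z (¬bz ∘ inj₁)
  valid-before s (inj₂ (_ , u , fu , bu , _ , only)) f with one-forcer fu f
  ... | refl = bu , only

  forcer-blue : ∀ j s → AllBlue Γ B F (j + s) → ∀ {u w} → F (u , w) ≡ true →
    ¬ Blue Γ B F s w → Blue Γ' B' F' j u
  forcer-blue zero s all {w = w} _ w-white = ⊥-elim (w-white (all w))
  forcer-blue (suc j) s all {u} {w} f w-white with blue? Γ' B' F' j u
  ... | yes bu = inj₁ bu
  ... | no ¬bu = inj₂ (¬bu , w , f , blue-if-targets-white w targets-of-w , along-arc f , only)
    where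
    blue-if-targets-white : ∀ x → (∀ {y} → F (x , y) ≡ true → ¬ Blue Γ B F (suc s) y) →
      Blue Γ' B' F' j x
    blue-if-targets-white x white with forces? x
    ... | no ¬f = initial-blue Γ' B' F' j (terminal-in-B' λ y fy → ¬f (y , fy))
    ... | yes (y , fy) =
      forcer-blue j (suc s) (subst (AllBlue Γ B F) (sym (+-suc j s)) all) fy (white fy)
    targets-of-w : ∀ {y} → F (w , y) ≡ true → ¬ Blue Γ B F (suc s) y
    targets-of-w fy by = w-white (proj₁ (valid-before s by fy))
    only : ∀ x → arc Γ' w x ≡ true → ¬ Blue Γ' B' F' j x → x ≡ u
    only x x→w ¬bx with x ≟ u
    ... | yes x≡u = x≡u
    ... | no x≢u = ⊥-elim (¬bx (blue-if-targets-white x λ {y} fy by →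
            let w≡y = proj₂ (valid-before s by fy) w x→w w-white
            in x≢u (one-forcer (subst (λ z → F (x , z) ≡ true) (sym w≡y) fy) f)))

  allBlue-transpose : ∀ t → AllBlue Γ B F t → AllBlue Γ' B' F' t
  allBlue-transpose t all v with forces? v
  ... | no ¬f = initial-blue Γ' B' F' t (terminal-in-B' λ y fy → ¬f (y , fy))
  ... | yes (y , fy) =
    forcer-blue t 0 (subst (AllBlue Γ B F) (sym (+-identityʳ t)) all) fy (target-white fy)

record Config {n} (Γ : Digraph n) : Set where
  constructor config
  field
    initial       : Subset n
    forces        : ForceSet n
    time          : ℕ
    isSetOfForces : IsSetOfForces Γ initial forces
    hasTime       : PT Γ initial forces time
open Config

cost : ∀ {n} {Γ : Digraph n} → Config Γ → ℕ
cost c = ∣ initial c ∣ + time c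

module SetOfForces {n} {Γ : Digraph n} {B : Subset n} {F : ForceSet n} (sf : IsSetOfForces Γ B F) where
  order : List (Force n)
  order = proj₁ sf

  ∈order⇔ : ∀ f → (f ∈ₗ order) ⇔ (F f ≡ true)
  ∈order⇔ = proj₁ (proj₂ sf)

  valid : ValidSeq Γ B order
  valid = proj₁ (proj₂ (proj₂ sf))

  along-arc : ∀ {u w} → F (u , w) ≡ true → arc Γ u w ≡ true
  along-arc f = valid-arc Γ B order valid (from (∈order⇔ _) f)

  target-white : ∀ {u w} → F (u , w) ≡ true → w ∉ B
  target-white f = valid-target-white Γ B order valid (from (∈order⇔ _) f)

  one-forcer : ∀ {u u' w} → F (u , w) ≡ true → F (u' , w) ≡ true → u ≡ u'
  one-forcer f f' = valid-one-forcer Γ B order valid (from (∈order⇔ _) f) (from (∈order⇔ _) f')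

  one-target : ∀ {u w w'} → F (u , w) ≡ true → F (u , w') ≡ true → w ≡ w'
  one-target f f' = valid-one-target Γ B order valid (from (∈order⇔ _) f) (from (∈order⇔ _) f')

-- Transposition: the vertices T that force nothing, with the transposed forces
-- performed in reverse order, form a configuration of Γᵀ of the same cost.
-- |T| = |B| since both the forward and the reversed sequence paint n vertices
-- with the same number of forces; the propagation times agree by applying the
-- duality of times in both directions.
transposeConfig : ∀ {n} {Γ : Digraph n} (c : Config Γ) →
  Σ (Config (transpose Γ)) λ c' → cost c' ≡ cost c
transposeConfig {n} {Γ} (config B F t sf (all , minimal)) =
  config T F' t (transposeSeq order , ∈order'⇔ , valid' , stalled') (all' , minimal') ,
  cong (_+ t) ∣T∣≡∣B∣
  where
  open SetOfForces sf
  Γ' : Digraph n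
  Γ' = transpose Γ
  F' : ForceSet n
  F' = transposeForces F

  Terminal : Fin n → Set
  Terminal v = ∀ y → F (v , y) ≢ true

  terminals : Σ (Subset n) λ T → ∀ v → (v ∈ T) ⇔ Terminal v
  terminals = comprehension Terminal (λ v → all? λ y → ¬? (F (v , y) ≟ᵇ true))
  T : Subset n
  T = proj₁ terminals
  ∈T⇔ : ∀ v → (v ∈ T) ⇔ Terminal v
  ∈T⇔ = proj₂ terminals

  reversal : ValidSeq Γ' T (transposeSeq order) ×
             (∀ v → (v ∈ afterSeq T (transposeSeq order)) ⇔ (¬ ⊥))
  reversal = reverse-valid Γ B order (λ _ → ⊥) T valid (λ ()) λ v → mk⇔
    (λ v∈T → (λ ()) , λ (y , m) → to (∈T⇔ v) v∈T y (to (∈order⇔ _) m))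
    (λ (_ , ¬forcer) → from (∈T⇔ v) λ y fy → ¬forcer (y , from (∈order⇔ _) fy))
  valid' : ValidSeq Γ' T (transposeSeq order)
  valid' = proj₁ reversal

  painted' : ∀ v → v ∈ afterSeq T (transposeSeq order)
  painted' v = from (proj₂ reversal v) λ ()

  ∈order'⇔ : ∀ f → (f ∈ₗ transposeSeq order) ⇔ (F' f ≡ true)
  ∈order'⇔ (a , b) = ∈order⇔ (b , a) ⇔-∘ ∈-transposeSeq order

  stalled' : Stalled Γ' (afterSeq T (transposeSeq order))
  stalled' u w (_ , _ , w-white , _) = w-white (painted' w)

  all' : AllBlue Γ' T F' t
  all' = Duality.allBlue-transpose Γ B F T one-forcer target-white along-arc (from (∈T⇔ _))
           t all

  -- Every vertex is blue at time t, so a vertex that is never forced is in B.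
  untargeted-initial : ∀ {v} → (∀ u → F (u , v) ≢ true) → v ∈ B
  untargeted-initial {v} ¬f with blue-origin Γ B F t (all v)
  ... | inj₁ v∈B = v∈B
  ... | inj₂ (u , fu) = ⊥-elim (¬f u fu)

  minimal' : ∀ s → s < t → ¬ AllBlue Γ' T F' s
  minimal' s s<t all's = minimal s s<t
    (Duality.allBlue-transpose Γ' T F' B one-target (λ f w∈T → to (∈T⇔ _) w∈T _ f) along-arc
      untargeted-initial s all's)

  painted : ∀ v → v ∈ afterSeq B order
  painted v with blue-origin Γ B F t (all v)
  ... | inj₁ v∈B = afterSeq-mono B order v∈B
  ... | inj₂ (u , fu) = afterSeq-target B order (from (∈order⇔ _) fu)

  ∣T∣≡∣B∣ : ∣ T ∣ ≡ ∣ B ∣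
  ∣T∣≡∣B∣ = +-cancelʳ-≡ (length order) ∣ T ∣ ∣ B ∣ (begin
    ∣ T ∣ + length order                   ≡⟨ cong (∣ T ∣ +_) (sym (length-transposeSeq order)) ⟩
    ∣ T ∣ + length (transposeSeq order)    ≡⟨ valid-covers Γ' T (transposeSeq order) valid' painted' ⟩
    n                                      ≡⟨ sym (valid-covers Γ B order valid painted) ⟩
    ∣ B ∣ + length order                   ∎)
    where open ≡-Reasoning

-- Existence of the throttling number: whether cost m is achievable is decidable
-- (initial sets range over subsets, sets of forces are determined by orderings
-- of length at most n), so the least achievable cost exists.

_≟ᶠ_ : ∀ {n} (f g : Force n) → Dec (f ≡ g)
_≟ᶠ_ = ≡-dec _≟_ _≟_

forceSetOf : ∀ {n} → List (Force n) → ForceSet n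
forceSetOf {n} L f = isYes (DecMembership._∈?_ (_≟ᶠ_ {n}) f L)

∈⇔forceSetOf : ∀ {n} (L : List (Force n)) f → (f ∈ₗ L) ⇔ (forceSetOf L f ≡ true)
∈⇔forceSetOf {n} L f = mk⇔
  (λ m → to T-≡ (fromWitness {a? = DecMembership._∈?_ (_≟ᶠ_ {n}) f L} m))
  (λ e → toWitness {a? = DecMembership._∈?_ (_≟ᶠ_ {n}) f L} (from T-≡ e))

bool-ext : ∀ {b c : Bool} → (b ≡ true → c ≡ true) → (c ≡ true → b ≡ true) → b ≡ c
bool-ext {false} {false} _ _ = refl
bool-ext {false} {true} _ c→b = c→b refl
bool-ext {true} {false} b→c _ = sym (b→c refl)
bool-ext {true} {true} _ _ = refl

blue-cong : ∀ {n} (Γ : Digraph n) B {F G : ForceSet n} → (∀ f → F f ≡ G f) →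
  ∀ t {v} → Blue Γ B F t v → Blue Γ B G t v
blue-cong Γ B F≗G zero b = b
blue-cong Γ B F≗G (suc t) (inj₁ b) = inj₁ (blue-cong Γ B F≗G t b)
blue-cong Γ B F≗G (suc t) (inj₂ (¬bw , u , fu , bu , u→w , only)) =
  inj₂ (¬bw ∘ blue-cong Γ B (sym ∘ F≗G) t , u , trans (sym (F≗G _)) fu ,
        blue-cong Γ B F≗G t bu , u→w , λ x u→x ¬bx → only x u→x (¬bx ∘ blue-cong Γ B F≗G t))

pt-cong : ∀ {n} (Γ : Digraph n) B {F G : ForceSet n} → (∀ f → F f ≡ G f) → ∀ t → PT Γ B F t → PT Γ B G t
pt-cong Γ B F≗G t (all , minimal) =
  (λ v → blue-cong Γ B F≗G t (all v)) ,
  (λ s s<t all' → minimal s s<t (λ v → blue-cong Γ B (sym ∘ F≗G) s (all' v)))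

canForce? : ∀ {n} (Γ : Digraph n) S u w → Dec (CanForce Γ S u w)
canForce? Γ S u w = (u ∈? S) ×-dec (arc Γ u w ≟ᵇ true) ×-dec ¬? (w ∈? S) ×-dec
  all? (λ x → (arc Γ u x ≟ᵇ true) →-dec (¬? (x ∈? S) →-dec (x ≟ w)))

validSeq? : ∀ {n} (Γ : Digraph n) S L → Dec (ValidSeq Γ S L)
validSeq? Γ S [] = yes tt
validSeq? Γ S ((u , w) ∷ L) = canForce? Γ S u w ×-dec validSeq? Γ (S [ w ]≔ true) L

stalled? : ∀ {n} (Γ : Digraph n) S → Dec (Stalled Γ S)
stalled? Γ S = all? (λ u → all? (λ w → ¬? (canForce? Γ S u w)))

pt? : ∀ {n} (Γ : Digraph n) B F t → Dec (PT Γ B F t)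
pt? Γ B F t = allBlue? t ×-dec map′ (λ h s → h {s}) (λ h {s} → h s) (allUpTo? (¬? ∘ allBlue?) t)
  where
  allBlue? : ∀ s → Dec (AllBlue Γ B F s)
  allBlue? s = all? (blue? Γ B F s)

anyList? : ∀ {A : Set} → (∀ {Q : A → Set} → (∀ a → Dec (Q a)) → Dec (∃ Q)) →
  {P : List A → Set} → (∀ L → Dec (P L)) → ∀ k → Dec (∃ λ L → length L ≤ k × P L)
anyList? search P? zero = map′ (λ p → [] , z≤n , p) (λ { ([] , _ , p) → p }) (P? [])
anyList? search {P} P? (suc k) =
  map′ join split (P? [] ⊎-dec search (λ a → anyList? search (P? ∘ (a ∷_)) k))
  where
  join : P [] ⊎ ∃ (λ a → ∃ λ L → length L ≤ k × P (a ∷ L)) → ∃ λ L → length L ≤ suc k × P L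
  join (inj₁ p) = [] , z≤n , p
  join (inj₂ (a , L , len , p)) = a ∷ L , s≤s len , p
  split : (∃ λ L → length L ≤ suc k × P L) → P [] ⊎ ∃ (λ a → ∃ λ L → length L ≤ k × P (a ∷ L))
  split ([] , _ , p) = inj₁ p
  split (a ∷ L , s≤s len , p) = inj₂ (a , L , len , p)

anyForce? : ∀ {n} {Q : Force n → Set} → (∀ f → Dec (Q f)) → Dec (∃ Q)
anyForce? Q? = map′ (λ (u , w , q) → (u , w) , q) (λ ((u , w) , q) → u , w , q)
  (any? λ u → any? λ w → Q? (u , w))

Achievable : ∀ {n} → Digraph n → ℕ → Set
Achievable Γ m = Σ (Config Γ) λ c → cost c ≡ m

Realises : ∀ {n} → Digraph n → ℕ → Subset n → List (Force n) → Set
Realises Γ m B L =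
  ValidSeq Γ B L × Stalled Γ (afterSeq B L) × ∣ B ∣ ≤ m × PT Γ B (forceSetOf L) (m ∸ ∣ B ∣)

realises? : ∀ {n} (Γ : Digraph n) m B L → Dec (Realises Γ m B L)
realises? Γ m B L = validSeq? Γ B L ×-dec stalled? Γ (afterSeq B L) ×-dec (∣ B ∣ ≤ℕ? m) ×-dec
  pt? Γ B (forceSetOf L) (m ∸ ∣ B ∣)

achievable⇒realised : ∀ {n} (Γ : Digraph n) m → Achievable Γ m →
  ∃ λ B → ∃ λ L → length L ≤ n × Realises Γ m B L
achievable⇒realised {n} Γ _ (config B F t (L , ∈L⇔ , valid , stalled) pt , refl) =
  B , L , length≤n , valid , stalled , m≤m+n ∣ B ∣ t ,
  subst (PT Γ B (forceSetOf L)) (sym (m+n∸m≡n ∣ B ∣ t)) (pt-cong Γ B F≗ t pt)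
  where
  length≤n : length L ≤ n
  length≤n = m+n≤o⇒n≤o ∣ B ∣ (subst (_≤ n) (∣afterSeq∣ Γ B L valid) (∣p∣≤n (afterSeq B L)))
  F≗ : ∀ f → F f ≡ forceSetOf L f
  F≗ f = bool-ext (to (∈⇔forceSetOf L f) ∘ from (∈L⇔ f)) (to (∈L⇔ f) ∘ from (∈⇔forceSetOf L f))

realised⇒achievable : ∀ {n} (Γ : Digraph n) m → (∃ λ B → ∃ λ L → length L ≤ n × Realises Γ m B L) →
  Achievable Γ m
realised⇒achievable Γ m (B , L , _ , valid , stalled , ∣B∣≤m , pt) =
  config B (forceSetOf L) (m ∸ ∣ B ∣) (L , ∈⇔forceSetOf L , valid , stalled) pt , m+[n∸m]≡n ∣B∣≤m

achievable? : ∀ {n} (Γ : Digraph n) m → Dec (Achievable Γ m)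
achievable? {n} Γ m = map′ (realised⇒achievable Γ m) (achievable⇒realised Γ m)
  (anySubset? λ B → anyList? anyForce? (realises? Γ m B) n)

trivialConfig : ∀ {n} (Γ : Digraph n) → Achievable Γ n
trivialConfig {n} Γ =
  config everyone (λ _ → false) 0
    ([] , (λ f → mk⇔ (λ ()) (λ ())) , tt , λ u w (_ , _ , w-white , _) → w-white ∈⊤)
    ((λ v → ∈⊤) , λ s ()) ,
  trans (+-identityʳ _) (∣⊤∣≡n n)

least-below : ∀ {P : ℕ → Set} → (∀ m → Dec (P m)) → ∀ N → (∃ λ m → m ≤ N × P m) →
  ∃ λ k → P k × (∀ m → P m → k ≤ m)
least-below P? zero (_ , z≤n , p) = 0 , p , λ _ _ → z≤n
least-below {P} P? (suc N) (m , m≤N+1 , pm) with anyUpTo? P? (suc N)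
... | yes (m' , s≤s m'≤N , pm') = least-below P? N (m' , m'≤N , pm')
... | no none = suc N , P[N+1] , λ m' pm' → ≮⇒≥ λ m'<N+1 → none (m' , m'<N+1 , pm')
  where
  P[N+1] : P (suc N)
  P[N+1] with m≤n⇒m<n∨m≡n m≤N+1
  ... | inj₁ m<N+1 = ⊥-elim (none (m , m<N+1 , pm))
  ... | inj₂ refl = pm

throttling-exists : ∀ {n} (Γ : Digraph n) → ∃ λ k → IsThrottlingNumber Γ k
throttling-exists {n} Γ with least-below (achievable? Γ) n (n , ≤-refl , trivialConfig Γ)
... | k , (config B F t sf pt , cost≡k) , minimal =
  k , (B , F , t , sf , pt , cost≡k) , λ B' F' t' sf' pt' → minimal _ (config B' F' t' sf' pt' , refl)

-- Transposition preserves the throttling number: it maps configurations of Γ to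
-- configurations of Γᵀ of the same cost, and back, as Γᵀᵀ is Γ.
throttling-transpose : ∀ {n} {Γ : Digraph n} {k} →
  IsThrottlingNumber Γ k → IsThrottlingNumber (transpose Γ) k
throttling-transpose {Γ = Γ} {k} ((B , F , t , sf , pt , cost≡k) , minimal)
  with transposeConfig (config B F t sf pt)
... | config B' F' t' sf' pt' , same = (B' , F' , t' , sf' , pt' , trans same cost≡k) , lower
  where
  lower : ∀ B₁ F₁ t₁ → IsSetOfForces (transpose Γ) B₁ F₁ → PT (transpose Γ) B₁ F₁ t₁ → k ≤ ∣ B₁ ∣ + t₁
  lower B₁ F₁ t₁ sf₁ pt₁ with transposeConfig (config B₁ F₁ t₁ sf₁ pt₁)
  ... | config B₀ F₀ t₀ sf₀ pt₀ , same₁ = subst (k ≤_) same₁ (minimal B₀ F₀ t₀ sf₀ pt₀)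

theorem2p13 : ∀ (n : ℕ) (Γ : Digraph n) →
  Σ ℕ (λ k → IsThrottlingNumber Γ k × IsThrottlingNumber (transpose Γ) k)
theorem2p13 n Γ = let (k , isTh) = throttling-exists Γ in k , isTh , throttling-transpose isTh
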